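{- Let $\mathcal{K}=(E,\mathcal{I},c,p,\beta)$ be a BMI instance, $0<\varepsilon<\frac12$, let $R$ be the output of FindRep$(\mathcal{K},\varepsilon)$ and $\alpha$ the value computed in its second step. Then for every $r\in[\log_{1-\varepsilon}(\frac{\varepsilon}{2})+1]$, the set $R\cap C_r(\alpha)$ is a minimum basis with respect to $c$ of the matroid $\left[(E,\mathcal{I})\cap C_r(\alpha)\right]_{\le q(\varepsilon)}$.
   Context: A BMI instance is $\mathcal{K}=(E,\mathcal{I},c,p,\beta)$ with $E$ a finite ground set, $(E,\mathcal{I})$ a matroid, $\beta>0$, $c:E\to[0,\beta]$, $p:E\to\mathbb{R}_{\ge0}$; a solution is $X\in\mathcal{I}$ with $c(X)=\sum_{e\in X}c(e)\le\beta$; $\mathrm{OPT}(\mathcal{K})$ is the maximum profit $p(X)=\sum_{e\in X}p(e)$ of a solution. Let $q(\varepsilon)=\varepsilon^{ -\varepsilon^{ -1}}$ and $[k]=\{1,\dots,\lfloor k\rfloor\}$. Matroid operations: restriction $(E,\mathcal{I})\cap F=(F,\{A\in\mathcal{I}:A\subseteq F\})$; truncation $[(E,\mathcal{I})]_{\le q}=(E,\{A\in\mathcal{I}:|A|\le q\})$; union of matroids $(E_i,\mathcal{I}_i)_{i}$ is the matroid on $\bigcup_iE_i$ with independent sets $\{\bigcup_iF_i:F_i\in\mathcal{I}_i\}$. A minimum basis w.r.t. $c$ is a maximal independent set of minimum total cost among all maximal independent sets. Algorithm FindRep$(\mathcal{K},\varepsilon)$: (1) compute a solution $S^*$ with $p(S^*)\ge\mathrm{OPT}(\mathcal{K})/2$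 via a PTAS for BMI with parameter $1/2$; (2) set $\alpha=p(S^*)$; (3) with $C_r(\alpha)=\{e\in E:\frac{p(e)}{2\alpha}\in((1-\varepsilon)^r,(1-\varepsilon)^{r-1}]\}$ for $r\in[\log_{1-\varepsilon}(\frac{\varepsilon}{2})+1]$, return a minimum basis w.r.t. $c$ of $\bigvee_{r\in[\log_{1-\varepsilon}(\frac{\varepsilon}{2})+1]}\left[(E,\mathcal{I})\cap C_r(\alpha)\right]_{\le q(\varepsilon)}$.
   Formalization: The costs c, the profits p, the budget β and the parameter ε are taken in the rationals rather than the reals. -}

module Defs where

open import Data.Nat as ℕ using (ℕ; zero; suc)
import Data.Integer as ℤ
open import Data.Rational as ℚ using (ℚ; 0ℚ; 1ℚ; _+_; _*_; _-_; _<_; _≤_; _<?_; _≤?_; ↥_; ↧ₙ_; ½)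
open import Data.Fin using (Fin; zero; suc)
open import Data.Fin.Subset using (Subset; _∈_; _∉_; _⊆_; _∪_; _∩_; ⁅_⁆; ∣_∣; ⊥; inside; outside)
open import Data.Vec using (Vec; []; _∷_; tabulate)
open import Data.Bool using (Bool; true; false; _∧_)
open import Data.Product using (Σ; ∃; _×_; _,_)
open import Relation.Nullary using (¬_; does)

_^ℚ_ : ℚ → ℕ → ℚ
x ^ℚ zero    = 1ℚ
x ^ℚ (suc k) = x * (x ^ℚ k)

weight : ∀ {n} → (Fin n → ℚ) → Subset n → ℚ
weight {zero}  w []           = 0ℚ
weight {suc n} w (true ∷ X)   = w zero + weight (λ i → w (suc i)) X
weight {suc n} w (false ∷ X)  = weight (λ i → w (suc i)) X

record Matroid (n : ℕ) : Set₁ where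
  field
    Indep     : Subset n → Set
    indep-∅   : Indep ⊥
    indep-⊆   : ∀ {A B} → A ⊆ B → Indep B → Indep A
    exchange  : ∀ {A B} → Indep A → Indep B → ∣ A ∣ ℕ.< ∣ B ∣ →
                ∃ λ e → e ∈ B × e ∉ A × Indep (⁅ e ⁆ ∪ A)

IndepPred : ℕ → Set₁
IndepPred n = Subset n → Set

IsBasis : ∀ {n} → IndepPred n → Subset n → Set
IsBasis I B = I B × (∀ A → I A → B ⊆ A → A ⊆ B)

IsMinBasis : ∀ {n} → (Fin n → ℚ) → IndepPred n → Subset n → Set
IsMinBasis c I B = IsBasis I B × (∀ B′ → IsBasis I B′ → weight c B ≤ weight c B′)

Restrict : ∀ {n} → IndepPred n → Subset n → IndepPred n
Restrict I F A = I A × A ⊆ F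

record BMI (n : ℕ) : Set₁ where
  field
    M      : Matroid n
    c      : Fin n → ℚ
    p      : Fin n → ℚ
    β      : ℚ
    β-pos  : 0ℚ < β
    c-lo   : ∀ e → 0ℚ ≤ c e
    c-hi   : ∀ e → c e ≤ β
    p-nn   : ∀ e → 0ℚ ≤ p e

module _ {n : ℕ} (K : BMI n) where
  open BMI K
  open Matroid M

  IsSolution : Subset n → Set
  IsSolution X = Indep X × weight c X ≤ β

  -- p(S) ≥ OPT(K)/2, i.e. 2·p(S) ≥ p(X) for every solution X
  HalfApprox : Subset n → Set
  HalfApprox S = IsSolution S × (∀ X → IsSolution X → weight p X ≤ (1ℚ + 1ℚ) * weight p S)

  -- C_r(α) = { e : p(e)/(2α) ∈ ((1-ε)^r, (1-ε)^(r-1)] }, written multiplicatively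
  -- (2α)(1-ε)^r < p(e) ≤ (2α)(1-ε)^(r-1); index r ≥ 1.
  C : (ε α : ℚ) → ℕ → Subset n
  C ε α zero    = ⊥
  C ε α (suc k) = tabulate λ e →
    does (((1ℚ + 1ℚ) * α) * ((1ℚ - ε) ^ℚ (suc k)) <? p e) ∧
    does (p e ≤? ((1ℚ + 1ℚ) * α) * ((1ℚ - ε) ^ℚ k))

-- r ∈ [log_{1-ε}(ε/2) + 1] ⇔ 1 ≤ r ≤ log_{1-ε}(ε/2)+1 ⇔ 1 ≤ r and ε/2 ≤ (1-ε)^(r-1)  (0<ε<1)
InRange : ℚ → ℕ → Set
InRange ε zero    = Data.Empty.⊥ where import Data.Empty
InRange ε (suc k) = ε * ½ ≤ (1ℚ - ε) ^ℚ k

-- |A| ≤ q(ε) = ε^(-1/ε).  With ε = a/b (a,b > 0, lowest terms):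
-- k ≤ (b/a)^(b/a) ⇔ k^a ≤ (b/a)^b ⇔ k^a · a^b ≤ b^b
AtMostQ : ℚ → ℕ → Set
AtMostQ ε k = (k ℕ.^ a) ℕ.* (a ℕ.^ b) ℕ.≤ (b ℕ.^ b)
  where
  a = ℤ.∣ ↥ ε ∣
  b = ↧ₙ ε

Truncate : ∀ {n} → IndepPred n → ℚ → IndepPred n
Truncate I ε A = I A × AtMostQ ε ∣ A ∣

module _ {n : ℕ} (K : BMI n) where
  open BMI K
  open Matroid M

  Component : (ε α : ℚ) → ℕ → IndepPred n
  Component ε α r = Truncate (Restrict Indep (C K ε α r)) ε

  UnionIndep : (ε α : ℚ) → IndepPred n
  UnionIndep ε α X = Σ (ℕ → Subset n) λ F →
    (∀ r → InRange ε r → Component ε α r (F r)) ×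
    (∀ e → (e ∈ X → ∃ λ r → InRange ε r × e ∈ F r) ×
           (∀ r → InRange ε r → e ∈ F r → e ∈ X))

-- The classes C_r(α) are pairwise disjoint, since they are preimages under p of disjoint intervals
-- ((2α)(1-ε)^r, (2α)(1-ε)^(r-1)].  In a union of downward-closed set systems with disjoint
-- supports, replacing the part X ∩ C_r(α) of an independent set X by any other independent set
-- of the r-th system keeps it independent.  Maximality and minimality of R therefore transfer to
-- R ∩ C_r(α) by swapping that part with a competitor, since the cost of R splits as
-- c(R ∩ C_r(α)) + c(R ─ C_r(α)).
module Submission where

open import Defs
open import Data.Nat using (ℕ)
open import Data.Rational using (ℚ; 0ℚ; _<_; ½)
open import Data.Fin.Subset using (Subset; _∩_)

open import Data.Nat as ℕ using (zero; suc; _≤′_; ≤′-refl; ≤′-step)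
import Data.Nat.Properties as ℕ
import Data.Integer as ℤ
open import Data.Rational using (1ℚ; _+_; _*_; _-_; -_; _≤_; _≤?_; _<?_; ↥_; ↧ₙ_; NonNegative; nonNegative)
import Data.Rational.Properties as ℚ
open import Data.Fin using (Fin)
open import Data.Fin.Subset using (_∈_; _∉_; _⊆_; _∪_; _─_)
open import Data.Fin.Subset.Properties
open import Data.Vec using ([]; _∷_; here; there)
open import Data.Vec.Properties using (lookup∘tabulate; []=⇒lookup)
open import Data.Bool using (true; false)
open import Data.Product using (Σ; ∃; _×_; _,_; proj₁; proj₂)
open import Data.Sum using (_⊎_; inj₁; inj₂)
open import Data.Empty using (⊥-elim)
open import Relation.Nullary using (Dec; does; proof; yes; no)
open import Relation.Nullary.Reflects using (Reflects; invert)
open import Relation.Nullary.Decidable using (toWitness; _×-dec_)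
open import Relation.Binary using (tri<; tri≈; tri>)
open import Relation.Binary.PropositionalEquality

+-cancelʳ-≤ : ∀ {a b c : ℚ} → a + b ≤ c + b → a ≤ c
+-cancelʳ-≤ {a} {b} {c} a+b≤c+b =
  subst₂ _≤_ (+-neg-cancel a) (+-neg-cancel c) (ℚ.+-monoˡ-≤ (- b) a+b≤c+b)
  where
  +-neg-cancel : ∀ x → (x + b) - b ≡ x
  +-neg-cancel x = begin
    (x + b) - b   ≡⟨ ℚ.+-assoc x b (- b) ⟩
    x + (b - b)   ≡⟨ cong (x +_) (ℚ.+-inverseʳ b) ⟩
    x + 0ℚ        ≡⟨ ℚ.+-identityʳ x ⟩
    x             ∎
    where open ≡-Reasoning

0≤1-p : ∀ {p} → p ≤ 1ℚ → 0ℚ ≤ 1ℚ - p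
0≤1-p {p} p≤1 = subst (_≤ 1ℚ - p) (ℚ.+-inverseʳ p) (ℚ.+-monoˡ-≤ (- p) p≤1)

1-p≤1 : ∀ {p} → 0ℚ ≤ p → 1ℚ - p ≤ 1ℚ
1-p≤1 {p} 0≤p = subst (1ℚ - p ≤_) (ℚ.+-identityʳ 1ℚ) (ℚ.+-monoʳ-≤ 1ℚ (ℚ.neg-antimono-≤ 0≤p))

weight-nonNeg : ∀ {n} (w : Fin n → ℚ) → (∀ e → 0ℚ ≤ w e) → ∀ X → 0ℚ ≤ weight w X
weight-nonNeg w 0≤w []          = ℚ.≤-refl
weight-nonNeg w 0≤w (true ∷ X)  =
  ℚ.+-mono-≤ (0≤w Fin.zero) (weight-nonNeg (λ i → w (Fin.suc i)) (λ i → 0≤w (Fin.suc i)) X)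
weight-nonNeg w 0≤w (false ∷ X) = weight-nonNeg (λ i → w (Fin.suc i)) (λ i → 0≤w (Fin.suc i)) X

weight-∩-─ : ∀ {n} (w : Fin n → ℚ) X D → weight w X ≡ weight w (X ∩ D) + weight w (X ─ D)
weight-∩-─ w []          []          = sym (ℚ.+-identityˡ 0ℚ)
weight-∩-─ w (true ∷ X)  (true ∷ D)  =
  trans (cong (w Fin.zero +_) (weight-∩-─ (λ i → w (Fin.suc i)) X D))
        (sym (ℚ.+-assoc (w Fin.zero) _ _))
weight-∩-─ w (true ∷ X)  (false ∷ D) = begin
  w₀ + weight w′ X  ≡⟨ cong (w₀ +_) (weight-∩-─ w′ X D) ⟩
  w₀ + (A + B)      ≡⟨ ℚ.+-assoc w₀ A B ⟨
  (w₀ + A) + B      ≡⟨ cong (_+ B) (ℚ.+-comm w₀ A) ⟩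
  (A + w₀) + B      ≡⟨ ℚ.+-assoc A w₀ B ⟩
  A + (w₀ + B)      ∎
  where
  open ≡-Reasoning
  w′ : Fin _ → ℚ
  w′ i = w (Fin.suc i)
  w₀ A B : ℚ
  w₀ = w Fin.zero
  A = weight w′ (X ∩ D)
  B = weight w′ (X ─ D)
weight-∩-─ w (false ∷ X) (true ∷ D)  = weight-∩-─ (λ i → w (Fin.suc i)) X D
weight-∩-─ w (false ∷ X) (false ∷ D) = weight-∩-─ (λ i → w (Fin.suc i)) X D

module _ (x : ℚ) .{{_ : NonNegative x}} (x≤1 : x ≤ 1ℚ) where

  ^ℚ-nonNeg : ∀ k → NonNegative (x ^ℚ k)
  ^ℚ-nonNeg zero    = _
  ^ℚ-nonNeg (suc k) = ℚ.nonNeg*nonNeg⇒nonNeg x (x ^ℚ k) {{^ℚ-nonNeg k}}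

  ^ℚ-suc-≤ : ∀ k → x ^ℚ suc k ≤ x ^ℚ k
  ^ℚ-suc-≤ k = subst (x * (x ^ℚ k) ≤_) (ℚ.*-identityˡ (x ^ℚ k))
    (ℚ.*-monoʳ-≤-nonNeg (x ^ℚ k) {{^ℚ-nonNeg k}} x≤1)

  ^ℚ-antimono′ : ∀ {m k} → m ≤′ k → x ^ℚ k ≤ x ^ℚ m
  ^ℚ-antimono′ ≤′-refl             = ℚ.≤-refl
  ^ℚ-antimono′ (≤′-step {k} m≤′k) = ℚ.≤-trans (^ℚ-suc-≤ k) (^ℚ-antimono′ m≤′k)

  ^ℚ-antimono : ∀ {m k} → m ℕ.≤ k → x ^ℚ k ≤ x ^ℚ m
  ^ℚ-antimono m≤k = ^ℚ-antimono′ (ℕ.≤⇒≤′ m≤k)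

x∈p─q⇒x∉q : ∀ {n} {x : Fin n} (p q : Subset n) → x ∈ p ─ q → x ∉ q
x∈p─q⇒x∉q (_ ∷ p)    (true ∷ q)  (there x∈p─q) (there x∈q) = x∈p─q⇒x∉q p q x∈p─q x∈q
x∈p─q⇒x∉q (_ ∷ p)    (false ∷ q) (there x∈p─q) (there x∈q) = x∈p─q⇒x∉q p q x∈p─q x∈q
x∈p─q⇒x∉q (true ∷ p) (false ∷ q) here          ()

x∈p⇒x∈p∩q⊎x∈p─q : ∀ {n} {x : Fin n} {p} q → x ∈ p → x ∈ p ∩ q ⊎ x ∈ p ─ q
x∈p⇒x∈p∩q⊎x∈p─q {x = x} q x∈p with x ∈? q
... | yes x∈q = inj₁ (x∈p∩q⁺ (x∈p , x∈q))
... | no  x∉q = inj₂ (x∈p∧x∉q⇒x∈p─q x∈p x∉q)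

module _ {n} {X B D : Subset n} (B⊆D : B ⊆ D) where

  [p─q]∪r∩q≡r : ((X ─ D) ∪ B) ∩ D ≡ B
  [p─q]∪r∩q≡r = ⊆-antisym ⊆B (λ x∈B → x∈p∩q⁺ (q⊆p∪q (X ─ D) B x∈B , B⊆D x∈B))
    where
    ⊆B : ((X ─ D) ∪ B) ∩ D ⊆ B
    ⊆B x∈Y∩D with x∈p∩q⁻ _ D x∈Y∩D
    ... | x∈Y , x∈D with x∈p∪q⁻ (X ─ D) B x∈Y
    ... | inj₁ x∈X─D = ⊥-elim (x∈p─q⇒x∉q X D x∈X─D x∈D)
    ... | inj₂ x∈B   = x∈B

  [p─q]∪r─q≡p─q : ((X ─ D) ∪ B) ─ D ≡ X ─ D
  [p─q]∪r─q≡p─q = ⊆-antisym ⊆X─D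
    (λ x∈X─D → x∈p∧x∉q⇒x∈p─q (p⊆p∪q B x∈X─D) (x∈p─q⇒x∉q X D x∈X─D))
    where
    ⊆X─D : ((X ─ D) ∪ B) ─ D ⊆ X ─ D
    ⊆X─D x∈Y─D with x∈p∪q⁻ (X ─ D) B (p─q⊆p _ D x∈Y─D)
    ... | inj₁ x∈X─D = x∈X─D
    ... | inj₂ x∈B   = ⊥-elim (x∈p─q⇒x∉q _ D x∈Y─D (B⊆D x∈B))

⊆-[p─q]∪r : ∀ {n} {X Y Z D : Subset n} → X ∩ D ⊆ Z → X ─ D ⊆ Y → X ⊆ (Y ─ D) ∪ Z
⊆-[p─q]∪r {X = X} {Y} {Z} {D} X∩D⊆Z X─D⊆Y x∈X with x∈p⇒x∈p∩q⊎x∈p─q D x∈X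
... | inj₁ x∈X∩D = q⊆p∪q (Y ─ D) Z (X∩D⊆Z x∈X∩D)
... | inj₂ x∈X─D = p⊆p∪q Z (x∈p∧x∉q⇒x∈p─q (X─D⊆Y x∈X─D) (x∈p─q⇒x∉q X D x∈X─D))

-- UnionIndep K ε α unfolds to ⋁ (InRange ε) (Component K ε α).
⋁ : ∀ {n} → (ℕ → Set) → (ℕ → IndepPred n) → IndepPred n
⋁ {n} InR I X = Σ (ℕ → Subset n) λ F →
  (∀ r → InR r → I r (F r)) ×
  (∀ e → (e ∈ X → ∃ λ r → InR r × e ∈ F r) ×
         (∀ r → InR r → e ∈ F r → e ∈ X))

module DisjointUnion {n} (InR : ℕ → Set) (I : ℕ → IndepPred n) (D : ℕ → Subset n)
  (I-⊆ : ∀ {r A B} → A ⊆ B → I r B → I r A)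
  (I⊆D : ∀ {r A} → I r A → A ⊆ D r)
  (D-disjoint : ∀ {e r s} → e ∈ D r → e ∈ D s → r ≡ s) where

  ⋁-∩ : ∀ {X r} → ⋁ InR I X → InR r → I r (X ∩ D r)
  ⋁-∩ {X} {r} (F , IF , F-cover) inR = I-⊆ X∩D⊆F (IF r inR)
    where
    X∩D⊆F : X ∩ D r ⊆ F r
    X∩D⊆F {e} e∈X∩D with x∈p∩q⁻ X (D r) e∈X∩D
    ... | e∈X , e∈D with proj₁ (F-cover e) e∈X
    ... | s , inS , e∈Fs = subst (λ z → e ∈ F z) (D-disjoint (I⊆D (IF s inS) e∈Fs) e∈D) e∈Fs

  ⋁-swap : ∀ {X r B} → ⋁ InR I X → InR r → I r B → ⋁ InR I ((X ─ D r) ∪ B)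
  ⋁-swap {X} {r} {B} (F , IF , F-cover) inR IB = F′ , IF′ , λ e → cover⁺ e , cover⁻ e
    where
    F′ : ℕ → Subset n
    F′ s with s ℕ.≟ r
    ... | yes _ = B
    ... | no  _ = F s ─ D r

    IF′ : ∀ s → InR s → I s (F′ s)
    IF′ s inS with s ℕ.≟ r
    ... | yes refl = IB
    ... | no  _    = I-⊆ (p─q⊆p (F s) (D r)) (IF s inS)

    B⊆F′r : B ⊆ F′ r
    B⊆F′r e∈B with r ℕ.≟ r
    ... | yes _   = e∈B
    ... | no  r≢r = ⊥-elim (r≢r refl)

    X─D⊆F′ : ∀ {e s} → InR s → e ∈ X ─ D r → e ∈ F s → e ∈ F′ s
    X─D⊆F′ {s = s} inS e∈X─D e∈Fs with s ℕ.≟ r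
    ... | yes refl = ⊥-elim (x∈p─q⇒x∉q X (D r) e∈X─D (I⊆D (IF s inS) e∈Fs))
    ... | no  _    = x∈p∧x∉q⇒x∈p─q e∈Fs (x∈p─q⇒x∉q X (D r) e∈X─D)

    cover⁺ : ∀ e → e ∈ (X ─ D r) ∪ B → ∃ λ s → InR s × e ∈ F′ s
    cover⁺ e e∈Y with x∈p∪q⁻ (X ─ D r) B e∈Y
    ... | inj₂ e∈B   = r , inR , B⊆F′r e∈B
    ... | inj₁ e∈X─D with proj₁ (F-cover e) (p─q⊆p X (D r) e∈X─D)
    ... | s , inS , e∈Fs = s , inS , X─D⊆F′ inS e∈X─D e∈Fs

    cover⁻ : ∀ e s → InR s → e ∈ F′ s → e ∈ (X ─ D r) ∪ B
    cover⁻ e s inS e∈F′s with s ℕ.≟ r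
    ... | yes refl = q⊆p∪q (X ─ D r) B e∈F′s
    ... | no  _    = p⊆p∪q B (x∈p∧x∉q⇒x∈p─q
                       (proj₂ (F-cover e) s inS (p─q⊆p (F s) (D r) e∈F′s))
                       (x∈p─q⇒x∉q (F s) (D r) e∈F′s))

  isBasis-∩ : ∀ {R r} → IsBasis (⋁ InR I) R → InR r → IsBasis (I r) (R ∩ D r)
  isBasis-∩ {R} {r} (⋁R , R-max) inR = ⋁-∩ ⋁R inR , A-max
    where
    A-max : ∀ A → I r A → R ∩ D r ⊆ A → A ⊆ R ∩ D r
    A-max A IA R∩D⊆A e∈A = x∈p∩q⁺ (R′⊆R (q⊆p∪q (R ─ D r) A e∈A) , I⊆D IA e∈A)
      where
      R′⊆R : (R ─ D r) ∪ A ⊆ R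
      R′⊆R = R-max _ (⋁-swap ⋁R inR IA) (⊆-[p─q]∪r R∩D⊆A (p─q⊆p R (D r)))

  isBasis-swap : ∀ {R r B} → IsBasis (⋁ InR I) R → InR r → IsBasis (I r) B →
                 IsBasis (⋁ InR I) ((R ─ D r) ∪ B)
  isBasis-swap {R} {r} {B} (⋁R , R-max) inR (IB , B-max) = ⋁-swap ⋁R inR IB , R′-max
    where
    R′-max : ∀ A → ⋁ InR I A → (R ─ D r) ∪ B ⊆ A → A ⊆ (R ─ D r) ∪ B
    R′-max A ⋁A R′⊆A = ⊆-[p─q]∪r A∩D⊆B A─D⊆R
      where
      A∩D⊆B : A ∩ D r ⊆ B
      A∩D⊆B = B-max _ (⋁-∩ ⋁A inR)
        (λ e∈B → x∈p∩q⁺ (R′⊆A (q⊆p∪q (R ─ D r) B e∈B) , I⊆D IB e∈B))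

      A─D⊆R : A ─ D r ⊆ R
      A─D⊆R e∈A─D = R-max _ (⋁-swap ⋁A inR (⋁-∩ ⋁R inR))
        (⊆-[p─q]∪r (λ e∈R∩D → e∈R∩D) (λ e∈R─D → R′⊆A (p⊆p∪q B e∈R─D)))
        (p⊆p∪q (R ∩ D r) e∈A─D)

  isMinBasis-∩ : ∀ (c : Fin n → ℚ) {R r} → IsMinBasis c (⋁ InR I) R → InR r →
                 IsMinBasis c (I r) (R ∩ D r)
  isMinBasis-∩ c {R} {r} (basisR , R-min) inR = isBasis-∩ basisR inR , R∩D-min
    where
    R∩D-min : ∀ B → IsBasis (I r) B → weight c (R ∩ D r) ≤ weight c B
    R∩D-min B basisB = +-cancelʳ-≤ (subst₂ _≤_ (weight-∩-─ c R (D r)) swapped-weight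
      (R-min _ (isBasis-swap basisR inR basisB)))
      where
      B⊆D : B ⊆ D r
      B⊆D = I⊆D (proj₁ basisB)

      swapped-weight : weight c ((R ─ D r) ∪ B) ≡ weight c B + weight c (R ─ D r)
      swapped-weight = begin
        weight c ((R ─ D r) ∪ B)
          ≡⟨ weight-∩-─ c _ (D r) ⟩
        weight c (((R ─ D r) ∪ B) ∩ D r) + weight c (((R ─ D r) ∪ B) ─ D r)
          ≡⟨ cong₂ (λ U V → weight c U + weight c V) ([p─q]∪r∩q≡r B⊆D) ([p─q]∪r─q≡p─q B⊆D) ⟩
        weight c B + weight c (R ─ D r)
          ∎
        where open ≡-Reasoning

AtMostQ-antimono : ∀ ε {k k′} → k ℕ.≤ k′ → AtMostQ ε k′ → AtMostQ ε k
AtMostQ-antimono ε k≤k′ = ℕ.≤-trans (ℕ.*-monoˡ-≤ (a ℕ.^ b) (ℕ.^-monoˡ-≤ a k≤k′))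
  where
  a b : ℕ
  a = ℤ.∣ ↥ ε ∣
  b = ↧ₙ ε

module _ {n} (K : BMI n) (ε α : ℚ) where
  open BMI K
  open Matroid M

  Component-⊆ : ∀ {r A B} → A ⊆ B → Component K ε α r B → Component K ε α r A
  Component-⊆ A⊆B ((IB , B⊆C) , B-small) =
    (indep-⊆ A⊆B IB , ⊆-trans A⊆B B⊆C) , AtMostQ-antimono ε (p⊆q⇒∣p∣≤∣q∣ A⊆B) B-small

  Component⊆C : ∀ {r A} → Component K ε α r A → A ⊆ C K ε α r
  Component⊆C ((_ , A⊆C) , _) = A⊆C

  ∈C⁻ : ∀ {e} k → e ∈ C K ε α (suc k) →
        ((1ℚ + 1ℚ) * α) * ((1ℚ - ε) ^ℚ suc k) < p e × p e ≤ ((1ℚ + 1ℚ) * α) * ((1ℚ - ε) ^ℚ k)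
  ∈C⁻ {e} k e∈C = invert (subst (Reflects _) in-band (proof (in-band? e)))
    where
    t : ℚ
    t = (1ℚ + 1ℚ) * α

    in-band? : ∀ e′ → Dec (t * ((1ℚ - ε) ^ℚ suc k) < p e′ × p e′ ≤ t * ((1ℚ - ε) ^ℚ k))
    in-band? e′ = (t * ((1ℚ - ε) ^ℚ suc k) <? p e′) ×-dec (p e′ ≤? t * ((1ℚ - ε) ^ℚ k))

    in-band : does (in-band? e) ≡ true
    in-band = trans (sym (lookup∘tabulate (λ e′ → does (in-band? e′)) e)) ([]=⇒lookup e∈C)

  C-suc-disjoint : 0ℚ ≤ ε → ε ≤ 1ℚ → 0ℚ ≤ α →
                   ∀ {e i j} → i ℕ.< j → e ∈ C K ε α (suc i) → e ∉ C K ε α (suc j)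
  C-suc-disjoint 0≤ε ε≤1 0≤α {i = i} {j} i<j e∈Ci e∈Cj = ℚ.<-irrefl refl (begin-strict
    t * x ^ℚ suc i  <⟨ proj₁ (∈C⁻ i e∈Ci) ⟩
    p _             ≤⟨ proj₂ (∈C⁻ j e∈Cj) ⟩
    t * x ^ℚ j      ≤⟨ ℚ.*-monoˡ-≤-nonNeg t (^ℚ-antimono x (1-p≤1 0≤ε) i<j) ⟩
    t * x ^ℚ suc i  ∎)
    where
    open ℚ.≤-Reasoning
    x t : ℚ
    x = 1ℚ - ε
    t = (1ℚ + 1ℚ) * α
    instance
      _ : NonNegative x
      _ = nonNegative (0≤1-p ε≤1)
      _ : NonNegative t
      _ = ℚ.nonNeg*nonNeg⇒nonNeg (1ℚ + 1ℚ) α {{nonNegative 0≤α}}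

  C-disjoint : 0ℚ ≤ ε → ε ≤ 1ℚ → 0ℚ ≤ α →
               ∀ {e r s} → e ∈ C K ε α r → e ∈ C K ε α s → r ≡ s
  C-disjoint _   _   _   {r = zero}  e∈C _   = ⊥-elim (∉⊥ e∈C)
  C-disjoint _   _   _   {s = zero}  _   e∈C = ⊥-elim (∉⊥ e∈C)
  C-disjoint 0≤ε ε≤1 0≤α {r = suc i} {suc j} e∈Ci e∈Cj with ℕ.<-cmp i j
  ... | tri< i<j _ _ = ⊥-elim (C-suc-disjoint 0≤ε ε≤1 0≤α i<j e∈Ci e∈Cj)
  ... | tri≈ _ i≡j _ = cong suc i≡j
  ... | tri> _ _ j<i = ⊥-elim (C-suc-disjoint 0≤ε ε≤1 0≤α j<i e∈Cj e∈Ci)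

lemma4p4 : ∀ {n} (K : BMI n) (ε : ℚ) → 0ℚ < ε → ε < ½ →
           (S* : Subset n) → HalfApprox K S* →
           (R : Subset n) →
           IsMinBasis (BMI.c K) (UnionIndep K ε (weight (BMI.p K) S*)) R →
           ∀ r → InRange ε r →
           IsMinBasis (BMI.c K) (Component K ε (weight (BMI.p K) S*) r)
                      (R ∩ C K ε (weight (BMI.p K) S*) r)
lemma4p4 K ε 0<ε ε<½ S* _ R R-minBasis r inR =
  isMinBasis-∩ (BMI.c K) R-minBasis inR
  where
  α : ℚ
  α = weight (BMI.p K) S*
  0≤ε : 0ℚ ≤ ε
  0≤ε = ℚ.<⇒≤ 0<ε
  ε≤1 : ε ≤ 1ℚ
  ε≤1 = ℚ.<⇒≤ (ℚ.<-trans ε<½ (toWitness {a? = ½ <? 1ℚ} _))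
  0≤α : 0ℚ ≤ α
  0≤α = weight-nonNeg (BMI.p K) (BMI.p-nn K) S*
  open DisjointUnion (InRange ε) (Component K ε α) (C K ε α)
    (λ {r} → Component-⊆ K ε α {r}) (λ {r} → Component⊆C K ε α {r})
    (C-disjoint K ε α 0≤ε ε≤1 0≤α)
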